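{- Let $G=(V,E)$ be a DAG, let $C$ be a minimum vertex cover of $G$ with $|C|=\tau$, and let $k$ be a positive integer with $k<\tau$. Suppose some type has a vertex set $V_U$ with $|V_U|\ge 2k^{\tau}+2$, and let $u\in V_U$. Then $G$ admits a $k$-page upward book embedding if and only if $G-u$ admits a $k$-page upward book embedding.
   Context: Two vertices $u,v\in V\setminus C$ have the same type if they have the same neighbor set $U\subseteq C$ and, for every $w\in U$, the edges between $w$ and $u$ and between $w$ and $v$ have the same orientation (both directed toward $w$ or both away from $w$). For a type (with neighbor set $U$), $V_U$ denotes the set of vertices of that type. A $k$-page upward book embedding of a DAG $G=(V,E)$ is a pair $\langle \pi,\sigma\rangle$ where $\pi\colon V\to\{1,\dots,|V|\}$ is a bijection with $\pi(a)<\pi(b)$ for every directed edge $ab$, and $\sigma\colon E\to\{1,\dots,k\}$ is such that no two same-page edges cross; edges $ab,wx$ with $\pi(a)<\pi(b)$, $\pi(w)<\pi(x)$, $\pi(a)<\pi(w)$ cross if $\pi(a)<\pi(w)<\pi(b)<\pi(x)$. -}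

module Defs where

open import Data.Nat using (ℕ; suc; _+_; _*_; _^_; _≤_)
open import Data.Bool using (Bool; true; false)
open import Data.Fin using (Fin; punchIn) renaming (_<_ to _<ᶠ_)
open import Data.Fin.Subset using (Subset; _∈_; _∉_; ∣_∣)
open import Data.Product using (Σ; _×_; _,_)
open import Data.Sum using (_⊎_)
open import Relation.Nullary using (¬_)
open import Relation.Binary.PropositionalEquality using (_≡_)
open import Relation.Binary.Construct.Closure.Transitive using (TransClosure)
open import Function.Definitions using (Bijective)
open import Function.Bundles using (_⇔_)

Digraph : ℕ → Set
Digraph n = Fin n → Fin n → Bool

Edge : ∀ {n} → Digraph n → Fin n → Fin n → Set
Edge E a b = E a b ≡ true

IsDAG : ∀ {n} → Digraph n → Set
IsDAG E = ∀ v → ¬ TransClosure (Edge E) v v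

IsVertexCover : ∀ {n} → Digraph n → Subset n → Set
IsVertexCover E C = ∀ a b → Edge E a b → (a ∈ C) ⊎ (b ∈ C)

IsMinVertexCover : ∀ {n} → Digraph n → Subset n → Set
IsMinVertexCover E C =
  IsVertexCover E C × (∀ C′ → IsVertexCover E C′ → ∣ C ∣ ≤ ∣ C′ ∣)

SameType : ∀ {n} → Digraph n → Subset n → Fin n → Fin n → Set
SameType E C u v =
  u ∉ C × v ∉ C ×
  (∀ w → w ∈ C → (E w u ≡ E w v) × (E u w ≡ E v w))

record UpwardBookEmbedding {n} (k : ℕ) (E : Digraph n) : Set where
  field
    π        : Fin n → Fin n
    π-bij    : Bijective _≡_ _≡_ π
    σ        : (a b : Fin n) → Edge E a b → Fin k
    upward   : ∀ a b → Edge E a b → π a <ᶠ π b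
    noCross  : ∀ a b w x (e : Edge E a b) (f : Edge E w x) →
               σ a b e ≡ σ w x f →
               ¬ (π a <ᶠ π w × π w <ᶠ π b × π b <ᶠ π x)

HasUBE : ∀ {n} → ℕ → Digraph n → Set
HasUBE k E = UpwardBookEmbedding k E

deleteVertex : ∀ {m} → Digraph (suc m) → Fin (suc m) → Digraph m
deleteVertex E u i j = E (punchIn u i) (punchIn u j)

-- An embedding of G restricts to G − u. Conversely, fix a k-page upward book embedding of G − u.
-- All neighbours of a vertex of u's type lie in the vertex cover, so the pages of its edges form a
-- word of length at most τ over k letters; among the at least 2k^τ + 1 vertices of that type in G − u,
-- three, t₁, t₂, t₃, share the same word. If two distinct edges at t₁ were on one page, their other
-- endpoints and t₁, t₂, t₃ would form a K₂,₃ on that page, which cannot be drawn without crossings.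
-- So the edges at t₁ are on pairwise distinct pages, and u can be placed right after t₁, each edge
-- at u on the page of the corresponding edge at t₁.

module Submission where

open import Defs
open import Axiom.UniquenessOfIdentityProofs using (module Decidable⇒UIP)
open import Data.Bool using (true; false)
import Data.Bool as Bool
open import Data.Bool.Properties using (¬-not)
open import Data.Empty using (⊥; ⊥-elim)
open import Data.Fin
  using (Fin; zero; suc; toℕ; punchIn; punchOut; combine; _<?_; _≟_) renaming (_<_ to _<ᶠ_)
open import Data.Fin.Properties
  using (toℕ-injective; suc-injective; any?; pigeonhole; combine-injective; punchIn-injective; punchOut-injective;
         punchIn-mono-≤; punchIn-cancel-≤; punchOut-mono-≤; punchOut-cancel-≤; punchInᵢ≢i; punchIn-punchOut;
         <⇒≢; ≤∧≢⇒<; <-cmp)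
open import Data.Fin.Subset using (Subset; inside; outside; _∈_; _∉_; ∣_∣)
open import Data.Fin.Subset.Properties using (_∈?_; ∣p∣≤∣x∷p∣)
open import Data.Nat as ℕ using (ℕ; zero; suc; _+_; _*_; _^_; _≤_; _<_; s≤s; s≤s⁻¹; s<s⁻¹)
import Data.Nat.Properties as ℕ
open import Data.Product using (Σ; ∃; ∃₂; _×_; _,_; proj₁; proj₂)
open import Data.Sum using (_⊎_; inj₁; inj₂; [_,_]′)
import Data.Sum as Sum
open import Data.Vec using ([]; _∷_; here; there; removeAt)
open import Function.Base using (_∘_)
open import Function.Bundles using (_⇔_; mk⇔; Equivalence)
open import Function.Definitions using (Injective; Surjective)
open import Relation.Binary.Definitions using (tri<; tri≈; tri>)
open import Relation.Binary.PropositionalEquality using (_≡_; _≢_; refl; sym; trans; cong; subst)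
open import Relation.Nullary using (¬_; Dec; yes; no; contradiction)
open import Relation.Nullary.Decidable using (_×-dec_)

private variable
  m n k : ℕ

injective⇒surjective : (f : Fin n → Fin n) → Injective _≡_ _≡_ f → Surjective _≡_ _≡_ f
injective⇒surjective {suc n} f f-inj y with any? (λ x → f x ≟ y)
... | yes (x , fx≡y) = x , λ { refl → fx≡y }
... | no ∄x =
  let i , j , i<j , eq = pigeonhole (ℕ.n<1+n n) (λ x → punchOut (y≢f x))
  in ⊥-elim (<⇒≢ i<j (f-inj (punchOut-injective (y≢f i) (y≢f j) eq)))
  where
  y≢f : ∀ x → y ≢ f x
  y≢f x y≡fx = ∄x (x , sym y≡fx)

module _ (f : Fin n → Fin m) where

  private
    Repeated : Fin n → Set
    Repeated i = ∃ λ j → j <ᶠ i × f j ≡ f i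

    repeated? : ∀ i → Dec (Repeated i)
    repeated? i = any? λ j → (j <? i) ×-dec (f j ≟ f i)

    bit : ∀ {i} → Dec (Repeated i) → Fin 2
    bit (yes _) = suc zero
    bit (no _)  = zero

  -- Tagging each value with whether it occurred before turns a triple-free f into an injection into Fin (2 * m).
  pigeonhole₃ : 2 * m < n → ∃₂ λ i j → ∃ λ l → i <ᶠ j × j <ᶠ l × f i ≡ f j × f j ≡ f l
  pigeonhole₃ 2m<n
    with i , i′ , i<i′ , gi≡gi′ ← pigeonhole 2m<n (λ i → combine (bit (repeated? i)) (f i))
    with bits≡ , fi≡fi′ ← combine-injective _ _ _ _ gi≡gi′
    = triple (repeated? i) (repeated? i′) bits≡
    where
    triple : (r : Dec (Repeated i)) (r′ : Dec (Repeated i′)) → bit r ≡ bit r′ →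
             ∃₂ λ i j → ∃ λ l → i <ᶠ j × j <ᶠ l × f i ≡ f j × f j ≡ f l
    triple (yes (j , j<i , fj≡fi)) _ _ = j , i , i′ , j<i , i<i′ , fj≡fi , fi≡fi′
    triple (no _) (yes _) ()
    triple (no _) (no ¬r′) _ = ⊥-elim (¬r′ (i , i<i′ , fi≡fi′))

enumerate : (p : Subset n) → Fin ∣ p ∣ → Fin n
enumerate (inside ∷ p) zero = zero
enumerate (inside ∷ p) (suc i) = suc (enumerate p i)
enumerate (outside ∷ p) i = suc (enumerate p i)

enumerate-∈ : (p : Subset n) (i : Fin ∣ p ∣) → enumerate p i ∈ p
enumerate-∈ (inside ∷ p) zero = here
enumerate-∈ (inside ∷ p) (suc i) = there (enumerate-∈ p i)
enumerate-∈ (outside ∷ p) i = there (enumerate-∈ p i)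

enumerate-injective : (p : Subset n) → Injective _≡_ _≡_ (enumerate p)
enumerate-injective (inside ∷ p) {zero} {zero} _ = refl
enumerate-injective (inside ∷ p) {suc i} {suc j} eq = cong suc (enumerate-injective p (suc-injective eq))
enumerate-injective (outside ∷ p) eq = enumerate-injective p (suc-injective eq)

encode : ∀ {k} (p : Subset n) → (Fin n → Fin k) → Fin (k ^ ∣ p ∣)
encode [] g = zero
encode (inside ∷ p) g = combine (g zero) (encode p (g ∘ suc))
encode (outside ∷ p) g = encode p (g ∘ suc)

encode-injective : ∀ {k} (p : Subset n) {g h : Fin n → Fin k} →
                   encode p g ≡ encode p h → ∀ {x} → x ∈ p → g x ≡ h x
encode-injective (inside ∷ p) {g} {h} eq here =
  proj₁ (combine-injective (g zero) (encode p (g ∘ suc)) (h zero) (encode p (h ∘ suc)) eq)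
encode-injective (inside ∷ p) {g} {h} eq (there x∈p) =
  encode-injective p (proj₂ (combine-injective (g zero) _ (h zero) _ eq)) x∈p
encode-injective (outside ∷ p) eq (there x∈p) = encode-injective p eq x∈p

∈-removeAt⁺ : (p : Subset (suc n)) (u : Fin (suc n)) {i : Fin n} → punchIn u i ∈ p → i ∈ removeAt p u
∈-removeAt⁺ (_ ∷ p) zero (there i∈p) = i∈p
∈-removeAt⁺ (_ ∷ _ ∷ p) (suc u) {zero} here = here
∈-removeAt⁺ (_ ∷ _ ∷ p) (suc u) {suc i} (there i∈p) = there (∈-removeAt⁺ (_ ∷ p) u i∈p)

∈-removeAt⁻ : (p : Subset (suc n)) (u : Fin (suc n)) {i : Fin n} → i ∈ removeAt p u → punchIn u i ∈ p
∈-removeAt⁻ (_ ∷ p) zero i∈p = there i∈p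
∈-removeAt⁻ (_ ∷ _ ∷ p) (suc u) {zero} here = here
∈-removeAt⁻ (_ ∷ _ ∷ p) (suc u) {suc i} (there i∈p) = there (∈-removeAt⁻ (_ ∷ p) u i∈p)

∣removeAt∣≤ : (p : Subset (suc n)) (u : Fin (suc n)) → ∣ removeAt p u ∣ ≤ ∣ p ∣
∣removeAt∣≤ (x ∷ p) zero = ∣p∣≤∣x∷p∣ x p
∣removeAt∣≤ (inside ∷ _ ∷ p) (suc u) = s≤s (∣removeAt∣≤ (_ ∷ p) u)
∣removeAt∣≤ (outside ∷ _ ∷ p) (suc u) = ∣removeAt∣≤ (_ ∷ p) u

≤1+∣removeAt∣ : (p : Subset (suc n)) (u : Fin (suc n)) → ∣ p ∣ ≤ suc ∣ removeAt p u ∣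
≤1+∣removeAt∣ (inside ∷ p) zero = ℕ.≤-refl
≤1+∣removeAt∣ (outside ∷ p) zero = ℕ.n≤1+n _
≤1+∣removeAt∣ (inside ∷ _ ∷ p) (suc u) = s≤s (≤1+∣removeAt∣ (_ ∷ p) u)
≤1+∣removeAt∣ (outside ∷ _ ∷ p) (suc u) = ≤1+∣removeAt∣ (_ ∷ p) u

punchIn-mono-< : ∀ (i : Fin (suc n)) {j l} → j <ᶠ l → punchIn i j <ᶠ punchIn i l
punchIn-mono-< i {j} {l} j<l =
  ≤∧≢⇒< (punchIn-mono-≤ i j l (ℕ.<⇒≤ j<l)) (λ eq → <⇒≢ j<l (punchIn-injective i j l eq))

punchIn-cancel-< : ∀ (i : Fin (suc n)) {j l} → punchIn i j <ᶠ punchIn i l → j <ᶠ l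
punchIn-cancel-< i {j} {l} lt = ≤∧≢⇒< (punchIn-cancel-≤ i j l (ℕ.<⇒≤ lt)) (λ { refl → <⇒≢ lt refl })

punchOut-mono-< : ∀ {i j l : Fin (suc n)} (i≢j : i ≢ j) (i≢l : i ≢ l) → j <ᶠ l → punchOut i≢j <ᶠ punchOut i≢l
punchOut-mono-< i≢j i≢l j<l =
  ≤∧≢⇒< (punchOut-mono-≤ i≢j i≢l (ℕ.<⇒≤ j<l)) (λ eq → <⇒≢ j<l (punchOut-injective i≢j i≢l eq))

punchOut-cancel-< : ∀ {i j l : Fin (suc n)} (i≢j : i ≢ j) (i≢l : i ≢ l) → punchOut i≢j <ᶠ punchOut i≢l → j <ᶠ l
punchOut-cancel-< i≢j i≢l lt =
  ≤∧≢⇒< (punchOut-cancel-≤ i≢j i≢l (ℕ.<⇒≤ lt)) (λ { refl → <⇒≢ lt refl })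

toℕ-punchIn-< : ∀ (i : Fin (suc n)) (j : Fin n) → toℕ j < toℕ i → toℕ (punchIn i j) ≡ toℕ j
toℕ-punchIn-< (suc i) zero    _        = refl
toℕ-punchIn-< (suc i) (suc j) (s≤s lt) = cong suc (toℕ-punchIn-< i j lt)

toℕ-punchIn-≥ : ∀ (i : Fin (suc n)) (j : Fin n) → toℕ i ≤ toℕ j → toℕ (punchIn i j) ≡ suc (toℕ j)
toℕ-punchIn-≥ zero    j       _        = refl
toℕ-punchIn-≥ (suc i) (suc j) (s≤s le) = cong suc (toℕ-punchIn-≥ i j le)

data PunchInView (u : Fin (suc m)) : Fin (suc m) → Set where
  hole    : PunchInView u u
  punched : (i : Fin m) → PunchInView u (punchIn u i)

punchInView : (u x : Fin (suc m)) → PunchInView u x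
punchInView u x with u ≟ x
... | yes refl = hole
... | no u≢x   = subst (PunchInView u) (punchIn-punchOut u≢x) (punched (punchOut u≢x))

Twins : Digraph n → Fin n → Fin n → Set
Twins E a b = ∀ w → E a w ≡ E b w × E w a ≡ E w b

deleteVertex-twins : ∀ {E : Digraph (suc n)} {u i j} → Twins E u (punchIn u i) → Twins E u (punchIn u j) →
                     Twins (deleteVertex E u) i j
deleteVertex-twins {u = u} u≈i u≈j w =
  trans (sym (proj₁ (u≈i (punchIn u w)))) (proj₁ (u≈j (punchIn u w))) ,
  trans (sym (proj₂ (u≈i (punchIn u w)))) (proj₂ (u≈j (punchIn u w)))

noEdgeOutside : ∀ {E : Digraph n} {C a b} → IsVertexCover E C → a ∉ C → b ∉ C → E a b ≡ false
noEdgeOutside cover a∉C b∉C = ¬-not λ e → [ a∉C , b∉C ]′ (cover _ _ e)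

sameType⇒twins : ∀ {E : Digraph n} {C u v} → IsVertexCover E C → SameType E C u v → Twins E u v
sameType⇒twins {C = C} cover (u∉C , v∉C , agree) w with w ∈? C
... | yes w∈C = proj₂ (agree w w∈C) , proj₁ (agree w w∈C)
... | no w∉C  = trans (noEdgeOutside cover u∉C w∉C) (sym (noEdgeOutside cover v∉C w∉C)) ,
                trans (noEdgeOutside cover w∉C u∉C) (sym (noEdgeOutside cover w∉C v∉C))

removeAt-vertexCover : ∀ {E : Digraph (suc n)} {C} u → IsVertexCover E C →
                       IsVertexCover (deleteVertex E u) (removeAt C u)
removeAt-vertexCover {C = C} u cover _ _ e = Sum.map (∈-removeAt⁺ C u) (∈-removeAt⁺ C u) (cover _ _ e)

deleteVertex-ube : ∀ {E : Digraph (suc m)} u → HasUBE k E → HasUBE k (deleteVertex E u)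
deleteVertex-ube {m} u emb = record
  { π       = π′
  ; π-bij   = π′-injective , injective⇒surjective π′ π′-injective
  ; σ       = λ a b → σ (punchIn u a) (punchIn u b)
  ; upward  = λ a b e → punchOut-mono-< (πu≢ a) (πu≢ b) (upward _ _ e)
  ; noCross = λ a b w x e f same (l₁ , l₂ , l₃) →
      noCross _ _ _ _ e f same (cancel l₁ , cancel l₂ , cancel l₃)
  }
  where
  open UpwardBookEmbedding emb
  πu≢ : ∀ i → π u ≢ π (punchIn u i)
  πu≢ i eq = punchInᵢ≢i u i (sym (proj₁ π-bij eq))
  π′ : Fin m → Fin m
  π′ i = punchOut (πu≢ i)
  π′-injective : ∀ {i j} → π′ i ≡ π′ j → i ≡ j
  π′-injective {i} {j} eq = punchIn-injective u i j (proj₁ π-bij (punchOut-injective (πu≢ i) (πu≢ j) eq))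
  cancel : ∀ {i j} → π′ i <ᶠ π′ j → π (punchIn u i) <ᶠ π (punchIn u j)
  cancel = punchOut-cancel-< (πu≢ _) (πu≢ _)


-- a ~ b: a chord joins a and b on one page; pos: their positions along the spine.
module OnePage {V : Set} (pos : V → ℕ) (_~_ : V → V → Set)
  (~-sym : ∀ {a b} → a ~ b → b ~ a)
  (~-apart : ∀ {a b} → a ~ b → pos a ≢ pos b)
  (nonCrossing : ∀ {a b c d} → a ~ b → c ~ d → pos a < pos c → pos c < pos b → pos b < pos d → ⊥)
  where

  Inside Outside : V → V → V → Set
  Inside b d s = pos b < pos s × pos s < pos d
  Outside b d s = pos s < pos b ⊎ pos d < pos s

  inside-or-outside : ∀ {b d s} → s ~ b → s ~ d → Inside b d s ⊎ Outside b d s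
  inside-or-outside {b} {d} {s} s~b s~d with ℕ.<-cmp (pos s) (pos b) | ℕ.<-cmp (pos s) (pos d)
  ... | tri< s<b _ _ | _            = inj₂ (inj₁ s<b)
  ... | tri≈ _ s≡b _ | _            = ⊥-elim (~-apart s~b s≡b)
  ... | tri> _ _ b<s | tri< s<d _ _ = inj₁ (b<s , s<d)
  ... | tri> _ _ _   | tri≈ _ s≡d _ = ⊥-elim (~-apart s~d s≡d)
  ... | tri> _ _ _   | tri> _ _ d<s = inj₂ (inj₂ d<s)

  SameSide : V → V → V → V → Set
  SameSide b d s s′ = (Inside b d s × Inside b d s′) ⊎ (Outside b d s × Outside b d s′)

  private
    ordered : ∀ {b d s s′} → pos b < pos d → pos s < pos s′ → SameSide b d s s′ →
              s ~ b → s ~ d → s′ ~ b → s′ ~ d → ⊥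
    ordered b<d s<s′ (inj₁ ((b<s , _) , (_ , s′<d))) _ s~d s′~b _ = nonCrossing (~-sym s′~b) s~d b<s s<s′ s′<d
    ordered b<d s<s′ (inj₂ (inj₁ s<b , inj₁ s′<b)) s~b _ _ s′~d = nonCrossing s~b s′~d s<s′ s′<b b<d
    ordered b<d s<s′ (inj₂ (inj₁ s<b , inj₂ d<s′)) _ s~d s′~b _ = nonCrossing s~d (~-sym s′~b) s<b b<d d<s′
    ordered b<d s<s′ (inj₂ (inj₂ d<s , inj₁ s′<b)) _ _ _ _ = ℕ.<-asym (ℕ.<-trans s<s′ s′<b) (ℕ.<-trans b<d d<s)
    ordered b<d s<s′ (inj₂ (inj₂ d<s , inj₂ d<s′)) s~b _ _ s′~d = nonCrossing (~-sym s~b) (~-sym s′~d) b<d d<s s<s′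

    swap : ∀ {b d s s′} → SameSide b d s s′ → SameSide b d s′ s
    swap (inj₁ (i , i′)) = inj₁ (i′ , i)
    swap (inj₂ (o , o′)) = inj₂ (o′ , o)

    sameSide : ∀ {b d s s′} → pos b < pos d → pos s ≢ pos s′ → SameSide b d s s′ →
               s ~ b → s ~ d → s′ ~ b → s′ ~ d → ⊥
    sameSide {s = s} {s′} b<d s≢s′ side s~b s~d s′~b s′~d with ℕ.<-cmp (pos s) (pos s′)
    ... | tri< s<s′ _ _ = ordered b<d s<s′ side s~b s~d s′~b s′~d
    ... | tri≈ _ s≡s′ _ = s≢s′ s≡s′
    ... | tri> _ _ s′<s = ordered b<d s′<s (swap side) s′~b s′~d s~b s~d

    noK₂₃-ordered : ∀ {b d s₁ s₂ s₃} → pos b < pos d →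
                     pos s₁ ≢ pos s₂ → pos s₁ ≢ pos s₃ → pos s₂ ≢ pos s₃ →
                     s₁ ~ b → s₁ ~ d → s₂ ~ b → s₂ ~ d → s₃ ~ b → s₃ ~ d → ⊥
    noK₂₃-ordered b<d s₁≢s₂ s₁≢s₃ s₂≢s₃ s₁~b s₁~d s₂~b s₂~d s₃~b s₃~d
      with inside-or-outside s₁~b s₁~d | inside-or-outside s₂~b s₂~d | inside-or-outside s₃~b s₃~d
    ... | inj₁ i₁ | inj₁ i₂ | _       = sameSide b<d s₁≢s₂ (inj₁ (i₁ , i₂)) s₁~b s₁~d s₂~b s₂~d
    ... | inj₂ o₁ | inj₂ o₂ | _       = sameSide b<d s₁≢s₂ (inj₂ (o₁ , o₂)) s₁~b s₁~d s₂~b s₂~d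
    ... | inj₁ i₁ | inj₂ _  | inj₁ i₃ = sameSide b<d s₁≢s₃ (inj₁ (i₁ , i₃)) s₁~b s₁~d s₃~b s₃~d
    ... | inj₁ _  | inj₂ o₂ | inj₂ o₃ = sameSide b<d s₂≢s₃ (inj₂ (o₂ , o₃)) s₂~b s₂~d s₃~b s₃~d
    ... | inj₂ _  | inj₁ i₂ | inj₁ i₃ = sameSide b<d s₂≢s₃ (inj₁ (i₂ , i₃)) s₂~b s₂~d s₃~b s₃~d
    ... | inj₂ o₁ | inj₁ _  | inj₂ o₃ = sameSide b<d s₁≢s₃ (inj₂ (o₁ , o₃)) s₁~b s₁~d s₃~b s₃~d

  noK₂₃ : ∀ {b d s₁ s₂ s₃} → pos b ≢ pos d →
           pos s₁ ≢ pos s₂ → pos s₁ ≢ pos s₃ → pos s₂ ≢ pos s₃ →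
           s₁ ~ b → s₁ ~ d → s₂ ~ b → s₂ ~ d → s₃ ~ b → s₃ ~ d → ⊥
  noK₂₃ {b} {d} b≢d s₁≢s₂ s₁≢s₃ s₂≢s₃ s₁~b s₁~d s₂~b s₂~d s₃~b s₃~d with ℕ.<-cmp (pos b) (pos d)
  ... | tri< b<d _ _ = noK₂₃-ordered b<d s₁≢s₂ s₁≢s₃ s₂≢s₃ s₁~b s₁~d s₂~b s₂~d s₃~b s₃~d
  ... | tri≈ _ b≡d _ = b≢d b≡d
  ... | tri> _ _ d<b = noK₂₃-ordered d<b s₁≢s₂ s₁≢s₃ s₂≢s₃ s₁~d s₁~b s₂~d s₂~b s₃~d s₃~b

module Pages {H : Digraph n} (emb : UpwardBookEmbedding (suc k) H) where

  open UpwardBookEmbedding emb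

  Adjacent : Fin n → Fin n → Set
  Adjacent a b = Edge H a b ⊎ Edge H b a

  private
    edge? : ∀ a b → Dec (Edge H a b)
    edge? a b = H a b Bool.≟ true

    edge-irrelevant : ∀ {a b} (e e′ : Edge H a b) → e ≡ e′
    edge-irrelevant = Decidable⇒UIP.≡-irrelevant Bool._≟_

    no-2-cycle : ∀ {a b} → Edge H a b → Edge H b a → ⊥
    no-2-cycle e e′ = ℕ.<-asym (upward _ _ e) (upward _ _ e′)

  -- Junk value zero when a and b are not adjacent.
  page : Fin n → Fin n → Fin (suc k)
  page a b with edge? a b | edge? b a
  ... | yes e | _     = σ a b e
  ... | no _  | yes e = σ b a e
  ... | no _  | no _  = zero

  page-out : ∀ {a b} (e : Edge H a b) → page a b ≡ σ a b e
  page-out {a} {b} e with edge? a b | edge? b a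
  ... | yes e′ | _ = cong (σ a b) (edge-irrelevant e′ e)
  ... | no ¬e  | _ = contradiction e ¬e

  page-in : ∀ {a b} (e : Edge H b a) → page a b ≡ σ b a e
  page-in {a} {b} e with edge? a b | edge? b a
  ... | yes e′ | _      = ⊥-elim (no-2-cycle e′ e)
  ... | no _   | yes e′ = cong (σ b a) (edge-irrelevant e′ e)
  ... | no _   | no ¬e  = contradiction e ¬e

  page-sym : ∀ {a b} → Adjacent a b → page a b ≡ page b a
  page-sym (inj₁ e) = trans (page-out e) (sym (page-in e))
  page-sym (inj₂ e) = trans (page-in e) (sym (page-out e))

  SameProfile : Fin n → Fin n → Set
  SameProfile a b = ∀ {w} → Adjacent a w → Adjacent b w × page a w ≡ page b w

  PagesDistinctAt : Fin n → Set
  PagesDistinctAt a = ∀ {w w′} → w ≢ w′ → Adjacent a w → Adjacent a w′ → page a w ≢ page a w′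

  sameProfile : ∀ {D a b} → IsVertexCover H D → a ∉ D → Twins H a b →
                encode D (page a) ≡ encode D (page b) → SameProfile a b
  sameProfile {D} {a} {b} cover a∉D a≈b codes≡ {w} adj =
    adjacent adj , encode-injective D codes≡ (neighbour∈D adj)
    where
    adjacent : Adjacent a w → Adjacent b w
    adjacent (inj₁ e) = inj₁ (trans (sym (proj₁ (a≈b w))) e)
    adjacent (inj₂ e) = inj₂ (trans (sym (proj₂ (a≈b w))) e)
    neighbour∈D : Adjacent a w → w ∈ D
    neighbour∈D (inj₁ e) = [ (λ a∈D → contradiction a∈D a∉D) , (λ w∈D → w∈D) ]′ (cover a w e)
    neighbour∈D (inj₂ e) = [ (λ w∈D → w∈D) , (λ a∈D → contradiction a∈D a∉D) ]′ (cover w a e)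

  private
    pos : Fin n → ℕ
    pos a = toℕ (π a)

    pos-injective : ∀ {a b} → a ≢ b → pos a ≢ pos b
    pos-injective a≢b eq = a≢b (proj₁ π-bij (toℕ-injective eq))

    module OnPage (p : Fin (suc k)) where

      Chord : Fin n → Fin n → Set
      Chord a b = Adjacent a b × page a b ≡ p

      chord-sym : ∀ {a b} → Chord a b → Chord b a
      chord-sym (inj₁ e , pg) = inj₂ e , trans (sym (page-sym (inj₁ e))) pg
      chord-sym (inj₂ e , pg) = inj₁ e , trans (sym (page-sym (inj₂ e))) pg

      chord-apart : ∀ {a b} → Chord a b → pos a ≢ pos b
      chord-apart (inj₁ e , _) eq = ℕ.<-irrefl eq (upward _ _ e)
      chord-apart (inj₂ e , _) eq = ℕ.<-irrefl (sym eq) (upward _ _ e)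

      nonCrossing : ∀ {a b c d} → Chord a b → Chord c d → pos a < pos c → pos c < pos b → pos b < pos d → ⊥
      nonCrossing (inj₁ e , pe) (inj₁ f , pf) l₁ l₂ l₃ =
        noCross _ _ _ _ e f (trans (sym (page-out e)) (trans pe (trans (sym pf) (page-out f)))) (l₁ , l₂ , l₃)
      nonCrossing (inj₂ e , _) _ l₁ l₂ l₃ = ℕ.<-asym (upward _ _ e) (ℕ.<-trans l₁ l₂)
      nonCrossing (inj₁ _ , _) (inj₂ f , _) l₁ l₂ l₃ = ℕ.<-asym (upward _ _ f) (ℕ.<-trans l₂ l₃)

      open OnePage pos Chord chord-sym chord-apart nonCrossing public

  -- Otherwise w, w′ and a₁, a₂, a₃ would span a K₂,₃ on a single page.
  distinctPages : ∀ {a₁ a₂ a₃} → a₁ ≢ a₂ → a₁ ≢ a₃ → a₂ ≢ a₃ →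
                  SameProfile a₁ a₂ → SameProfile a₁ a₃ → PagesDistinctAt a₁
  distinctPages {a₁} a₁≢a₂ a₁≢a₃ a₂≢a₃ a₁≈a₂ a₁≈a₃ {w} {w′} w≢w′ adj adj′ p≡p′ =
    OnPage.noK₂₃ (page a₁ w) (pos-injective w≢w′)
      (pos-injective a₁≢a₂) (pos-injective a₁≢a₃) (pos-injective a₂≢a₃)
      (adj , refl) (adj′ , sym p≡p′) (copy a₁≈a₂ adj refl) (copy a₁≈a₂ adj′ (sym p≡p′))
      (copy a₁≈a₃ adj refl) (copy a₁≈a₃ adj′ (sym p≡p′))
    where
    copy : ∀ {b x p} → SameProfile a₁ b → Adjacent a₁ x → page a₁ x ≡ p → OnPage.Chord p b x
    copy a₁≈b adj pg = proj₁ (a₁≈b adj) , trans (sym (proj₂ (a₁≈b adj))) pg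

-- u is placed immediately to the right of its twin t, and every edge at u copies the page of the corresponding edge at t.
module Reinsertion {E : Digraph (suc m)} (u : Fin (suc m))
                   (emb : UpwardBookEmbedding (suc k) (deleteVertex E u)) (t : Fin m)
                   (twin : Twins E u (punchIn u t)) (distinct : Pages.PagesDistinctAt emb t) where

  open Pages emb
  open UpwardBookEmbedding emb
    renaming (π to π′; π-bij to π′-bij; σ to σ′; upward to upward′; noCross to noCross′)

  private
    H : Digraph m
    H = deleteVertex E u

    P : Fin m
    P = π′ t

    π′-injective : ∀ {i j} → π′ i ≡ π′ j → i ≡ j
    π′-injective = proj₁ π′-bij

    π′-apart : ∀ {i j} → π′ i <ᶠ π′ j → i ≢ j
    π′-apart lt refl = ℕ.<-irrefl refl lt

    collapse : ∀ {x} → PunchInView u x → Fin m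
    collapse hole        = t
    collapse (punched i) = i

    position : ∀ {x} → PunchInView u x → Fin (suc m)
    position hole        = suc P
    position (punched i) = punchIn (suc P) (π′ i)

    position-injective : ∀ {x y} (vx : PunchInView u x) (vy : PunchInView u y) → position vx ≡ position vy → x ≡ y
    position-injective hole        hole        _  = refl
    position-injective hole        (punched j) eq = ⊥-elim (punchInᵢ≢i (suc P) (π′ j) (sym eq))
    position-injective (punched i) hole        eq = ⊥-elim (punchInᵢ≢i (suc P) (π′ i) eq)
    position-injective (punched i) (punched j) eq =
      cong (punchIn u) (π′-injective (punchIn-injective (suc P) _ _ eq))

    position-mono : ∀ {x y} (vx : PunchInView u x) (vy : PunchInView u y) →
                    π′ (collapse vx) <ᶠ π′ (collapse vy) → position vx <ᶠ position vy
    position-mono hole        hole        lt = ⊥-elim (ℕ.<-irrefl refl lt)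
    position-mono hole        (punched j) lt =
      subst (suc (toℕ P) <_) (sym (toℕ-punchIn-≥ (suc P) (π′ j) lt)) (s≤s lt)
    position-mono (punched i) hole        lt =
      subst (_< suc (toℕ P)) (sym (toℕ-punchIn-< (suc P) (π′ i) (ℕ.m<n⇒m<1+n lt))) (ℕ.m<n⇒m<1+n lt)
    position-mono (punched i) (punched j) lt = punchIn-mono-< (suc P) lt

    -- The only pair whose order is not inherited from G − u is (t, u), which both collapse to t.
    position-reflect : ∀ {x y} (vx : PunchInView u x) (vy : PunchInView u y) → position vx <ᶠ position vy →
                       π′ (collapse vx) <ᶠ π′ (collapse vy) ⊎ (collapse vx ≡ t × collapse vy ≡ t × x ≢ u × y ≡ u)
    position-reflect hole hole lt = ⊥-elim (ℕ.<-irrefl refl lt)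
    position-reflect hole (punched j) lt with P <? π′ j
    ... | yes P<j = inj₁ P<j
    ... | no P≮j  = ⊥-elim (ℕ.<⇒≱ (ℕ.<-trans (ℕ.n<1+n _) lt′) j≤P)
      where
      j≤P : toℕ (π′ j) ≤ toℕ P
      j≤P = ℕ.≮⇒≥ P≮j
      lt′ : suc (toℕ P) < toℕ (π′ j)
      lt′ = subst (suc (toℕ P) <_) (toℕ-punchIn-< (suc P) (π′ j) (s≤s j≤P)) lt
    position-reflect (punched i) hole lt with <-cmp (π′ i) P
    ... | tri< i<P _ _ = inj₁ i<P
    ... | tri≈ _ i≡P _ = inj₂ (π′-injective i≡P , refl , punchInᵢ≢i u i , refl)
    ... | tri> _ _ P<i =
      ⊥-elim (ℕ.<-asym P<i (s<s⁻¹ (subst (_< suc (toℕ P)) (toℕ-punchIn-≥ (suc P) (π′ i) P<i) lt)))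
    position-reflect (punched i) (punched j) lt = inj₁ (punchIn-cancel-< (suc P) lt)

    collapse-edge : ∀ {x y} (vx : PunchInView u x) (vy : PunchInView u y) → E x y ≡ H (collapse vx) (collapse vy)
    collapse-edge hole        hole        = trans (proj₁ (twin u)) (proj₂ (twin (punchIn u t)))
    collapse-edge hole        (punched j) = proj₁ (twin (punchIn u j))
    collapse-edge (punched i) hole        = proj₂ (twin (punchIn u i))
    collapse-edge (punched i) (punched j) = refl

    r : Fin (suc m) → Fin m
    r x = collapse (punchInView u x)

    π : Fin (suc m) → Fin (suc m)
    π x = position (punchInView u x)

    π-injective : ∀ {x y} → π x ≡ π y → x ≡ y
    π-injective = position-injective (punchInView u _) (punchInView u _)

    edge : ∀ {a b} → Edge E a b → Edge H (r a) (r b)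
    edge {a} {b} e = trans (sym (collapse-edge (punchInView u a) (punchInView u b))) e

    σ : (a b : Fin (suc m)) → Edge E a b → Fin (suc k)
    σ a b e = σ′ (r a) (r b) (edge e)

    π-reflect : ∀ x y → π x <ᶠ π y → π′ (r x) <ᶠ π′ (r y) ⊎ (r x ≡ t × r y ≡ t × x ≢ u × y ≡ u)
    π-reflect x y = position-reflect (punchInView u x) (punchInView u y)

    sharedEndpoint : ∀ {a b c d} (e : Edge H a b) (f : Edge H c d) → σ′ a b e ≡ σ′ c d f →
                     (a ≡ t × c ≡ t × b ≢ d) ⊎ (b ≡ t × c ≡ t × a ≢ d) ⊎ (b ≡ t × d ≡ t × a ≢ c) → ⊥
    sharedEndpoint e f same (inj₁ (refl , refl , b≢d)) =
      distinct b≢d (inj₁ e) (inj₁ f) (trans (page-out e) (trans same (sym (page-out f))))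
    sharedEndpoint e f same (inj₂ (inj₁ (refl , refl , a≢d))) =
      distinct a≢d (inj₂ e) (inj₁ f) (trans (page-in e) (trans same (sym (page-out f))))
    sharedEndpoint e f same (inj₂ (inj₂ (refl , refl , a≢c))) =
      distinct a≢c (inj₂ e) (inj₂ f) (trans (page-in e) (trans same (sym (page-in f))))

    noCross : ∀ a b w x (e : Edge E a b) (f : Edge E w x) → σ a b e ≡ σ w x f →
              ¬ (π a <ᶠ π w × π w <ᶠ π b × π b <ᶠ π x)
    noCross a b w x e f same (l₁ , l₂ , l₃)
      with π-reflect a w l₁ | π-reflect w b l₂ | π-reflect b x l₃
    ... | inj₁ c₁ | inj₁ c₂ | inj₁ c₃ = noCross′ _ _ _ _ (edge e) (edge f) same (c₁ , c₂ , c₃)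
    ... | inj₂ (_ , _ , _ , w≡u) | inj₂ (_ , _ , w≢u , _) | _ = w≢u w≡u
    ... | _ | inj₂ (_ , _ , _ , b≡u) | inj₂ (_ , _ , b≢u , _) = b≢u b≡u
    ... | inj₂ (_ , _ , _ , refl) | inj₁ _ | inj₂ (_ , _ , _ , refl) = ℕ.<-asym l₂ l₃
    ... | inj₂ (ra≡t , rw≡t , _ , _) | inj₁ _ | inj₁ c₃ =
      sharedEndpoint (edge e) (edge f) same (inj₁ (ra≡t , rw≡t , π′-apart c₃))
    ... | inj₁ c₁ | inj₂ (rw≡t , rb≡t , _ , _) | inj₁ c₃ =
      sharedEndpoint (edge e) (edge f) same (inj₂ (inj₁ (rb≡t , rw≡t , π′-apart (ℕ.<-trans c₁ c₃′))))
      where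
      c₃′ : π′ (r w) <ᶠ π′ (r x)
      c₃′ = subst (λ v → π′ v <ᶠ π′ (r x)) (trans rb≡t (sym rw≡t)) c₃
    ... | inj₁ c₁ | inj₁ _ | inj₂ (rb≡t , rx≡t , _ , _) =
      sharedEndpoint (edge e) (edge f) same (inj₂ (inj₂ (rb≡t , rx≡t , π′-apart c₁)))

  embedding : HasUBE (suc k) E
  embedding = record
    { π       = π
    ; π-bij   = π-injective , injective⇒surjective π π-injective
    ; σ       = σ
    ; upward  = λ a b e → position-mono (punchInView u a) (punchInView u b) (upward′ _ _ (edge e))
    ; noCross = noCross
    }

module _ {m k} {E : Digraph (suc m)} {C} (u : Fin (suc m)) (cover : IsVertexCover E C)
         (T : Subset m) (sameType : ∀ {i} → i ∈ T → SameType E C u (punchIn u i))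
         (size : 2 * suc k ^ ∣ C ∣ < ∣ T ∣) (emb : HasUBE (suc k) (deleteVertex E u)) where

  open Pages emb

  private
    D : Subset m
    D = removeAt C u

    code : Fin m → Fin (suc k ^ ∣ D ∣)
    code i = encode D (page i)

    bound : 2 * suc k ^ ∣ D ∣ < ∣ T ∣
    bound = ℕ.≤-<-trans (ℕ.*-monoʳ-≤ 2 (ℕ.^-monoʳ-≤ (suc k) (∣removeAt∣≤ C u))) size

    t : Fin ∣ T ∣ → Fin m
    t = enumerate T

    t-injective : ∀ {j j′} → j <ᶠ j′ → t j ≢ t j′
    t-injective j<j′ eq = <⇒≢ j<j′ (enumerate-injective T eq)

    twinOfU : ∀ j → Twins E u (punchIn u (t j))
    twinOfU j = sameType⇒twins cover (sameType (enumerate-∈ T j))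

    sameProfileAt : ∀ {j j′} → code (t j) ≡ code (t j′) → SameProfile (t j) (t j′)
    sameProfileAt {j} {j′} = sameProfile (removeAt-vertexCover u cover)
      (λ tj∈D → proj₁ (proj₂ (sameType (enumerate-∈ T j))) (∈-removeAt⁻ C u tj∈D))
      (deleteVertex-twins {E = E} (twinOfU j) (twinOfU j′))

  twinReinsertion : HasUBE (suc k) E
  twinReinsertion
    with j₁ , j₂ , j₃ , j₁<j₂ , j₂<j₃ , c₁₂ , c₂₃ ← pigeonhole₃ (code ∘ t) bound
    = Reinsertion.embedding u emb (t j₁) (twinOfU j₁)
        (distinctPages (t-injective j₁<j₂) (t-injective j₁<j₃) (t-injective j₂<j₃)
          (sameProfileAt c₁₂) (sameProfileAt (trans c₁₂ c₂₃)))
    where j₁<j₃ = ℕ.<-trans j₁<j₂ j₂<j₃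

lemma17 : (m : ℕ) (E : Digraph (suc m)) → IsDAG E →
          (C : Subset (suc m)) → IsMinVertexCover E C →
          (k : ℕ) → 1 ≤ k → k < ∣ C ∣ →
          (u : Fin (suc m)) →
          (Σ (Subset (suc m)) λ VU →
             (∀ v → (v ∈ VU) ⇔ SameType E C u v) ×
             (2 * k ^ ∣ C ∣ + 2 ≤ ∣ VU ∣)) →
          HasUBE k E ⇔ HasUBE k (deleteVertex E u)
lemma17 m E _ C _ zero () _ _ _
lemma17 m E _ C (cover , _) (suc k) _ _ u (VU , type , size) =
  mk⇔ (deleteVertex-ube u) (twinReinsertion u cover (removeAt VU u) twin size′)
  where
  twin : ∀ {i} → i ∈ removeAt VU u → SameType E C u _
  twin i∈T = Equivalence.to (type _) (∈-removeAt⁻ VU u i∈T)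
  size′ : 2 * suc k ^ ∣ C ∣ < ∣ removeAt VU u ∣
  size′ = s≤s⁻¹ (subst (_≤ suc ∣ removeAt VU u ∣) (ℕ.+-comm (2 * suc k ^ ∣ C ∣) 2)
                  (ℕ.≤-trans size (≤1+∣removeAt∣ VU u)))
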